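{- For every integer $n\ge 3$, let $P_n$ denote the path on $n$ vertices. Then $\chi'_L(P_n)=2$ if $n=3$, and $\chi'_L(P_n)=3$ if $n\ge 4$.
   Context: All graphs are finite, simple and connected with at least three vertices. For a proper edge coloring $c:E(G)\to\{1,\dots,k\}$ of a graph $G$ (adjacent edges receive different colors), let $\pi=(\mathcal{C}_1,\dots,\mathcal{C}_k)$ be the ordered partition of $E(G)$ into color classes. For a vertex $v$ and an edge $e=xy$, $d(v,e)=\min\{d(v,x),d(v,y)\}$, and $d(v,\mathcal{C}_i)=\min\{d(v,e): e\in\mathcal{C}_i\}$. The edge color code of $v$ is $c_\pi(v)=(d(v,\mathcal{C}_1),\dots,d(v,\mathcal{C}_k))$. The coloring $c$ is an edge-locating coloring if distinct vertices have distinct edge color codes; the edge-locating chromatic number $\chi'_L(G)$ is the minimum $k$ for which $G$ has an edge-locating coloring with $k$ colors. -}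

module Defs where

open import Data.Nat using (ℕ; zero; suc; _≤_; _⊓_)
open import Data.Fin using (Fin; toℕ)
open import Data.Product using (Σ; ∃; ∃-syntax; _×_; _,_)
open import Data.Sum using (_⊎_)
open import Relation.Binary.PropositionalEquality using (_≡_; _≢_)
open import Relation.Nullary using (¬_)

record Graph (n : ℕ) : Set₁ where
  field
    Adj     : Fin n → Fin n → Set
    symAdj  : ∀ {x y} → Adj x y → Adj y x
    irrefl  : ∀ {x} → ¬ Adj x x
open Graph public

PathGraph : (n : ℕ) → Graph n
PathGraph n = record
  { Adj    = λ i j → (toℕ j ≡ suc (toℕ i)) ⊎ (toℕ i ≡ suc (toℕ j))
  ; symAdj = sw
  ; irrefl = irr
  }
  where
  open import Data.Sum using (inj₁; inj₂)
  open import Data.Nat.Properties using (1+n≢n)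
  open import Relation.Binary.PropositionalEquality using (sym)
  sw : ∀ {i j} → (toℕ j ≡ suc (toℕ i)) ⊎ (toℕ i ≡ suc (toℕ j))
               → (toℕ i ≡ suc (toℕ j)) ⊎ (toℕ j ≡ suc (toℕ i))
  sw (inj₁ p) = inj₂ p
  sw (inj₂ p) = inj₁ p
  irr : ∀ {i} → ¬ ((toℕ i ≡ suc (toℕ i)) ⊎ (toℕ i ≡ suc (toℕ i)))
  irr {i} (inj₁ p) = 1+n≢n (sym p)
  irr {i} (inj₂ p) = 1+n≢n (sym p)

module _ {n : ℕ} (G : Graph n) where

  data Walk : Fin n → Fin n → ℕ → Set where
    here : ∀ {u} → Walk u u zero
    step : ∀ {u w v k} → Adj G u w → Walk w v k → Walk u v (suc k)

  Dist : Fin n → Fin n → ℕ → Set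
  Dist u v d = Walk u v d × (∀ k → Walk u v k → d ≤ k)

  Connected : Set
  Connected = ∀ u v → ∃[ d ] Walk u v d

  EdgeDist : Fin n → Fin n → Fin n → ℕ → Set
  EdgeDist v x y m = ∃[ d₁ ] ∃[ d₂ ] (Dist v x d₁ × Dist v y d₂ × m ≡ d₁ ⊓ d₂)

  -- A proper edge colouring with colours Fin k. The colour of the edge xy is
  -- c x y a (a a proof of adjacency); it depends only on the unordered edge.
  record ProperEdgeColoring (k : ℕ) : Set where
    field
      col      : ∀ x y → Adj G x y → Fin k
      col-edge : ∀ x y (a : Adj G x y) (b : Adj G y x) → col x y a ≡ col y x b
      proper   : ∀ x y z (a : Adj G x y) (b : Adj G x z) → y ≢ z → col x y a ≢ col x z b
  open ProperEdgeColoring public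

  module _ {k : ℕ} (c : ProperEdgeColoring k) where

    ClassDist : Fin n → Fin k → ℕ → Set
    ClassDist v i m =
      (∃[ x ] ∃[ y ] Σ (Adj G x y) λ a → col c x y a ≡ i × EdgeDist v x y m)
      × (∀ x y (a : Adj G x y) → col c x y a ≡ i → ∀ m' → EdgeDist v x y m' → m ≤ m')

    EdgeLocating : Set
    EdgeLocating = ∀ u v → u ≢ v →
      ∃[ i ] ∃[ m ] ∃[ m' ] (ClassDist u i m × ClassDist v i m' × m ≢ m')

  HasEdgeLocatingColoring : ℕ → Set
  HasEdgeLocatingColoring k = Σ (ProperEdgeColoring k) EdgeLocating

  EdgeLocChromaticNumber : ℕ → Set
  EdgeLocChromaticNumber k =
    HasEdgeLocatingColoring k × (∀ j → HasEdgeLocatingColoring j → k ≤ j)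

-- In P_n a colour class that contains only the first edge 01 places every vertex v
-- at distance v ∸ 1 from it, which separates all pairs except {0, 1}; these two are
-- separated by the colour of the edge 12. With 2 colours on P_3 the first edge can
-- carry its own colour; for n ≥ 4 this needs a third colour, since the interior
-- vertices 1 and 2 see both of only two colours and hence both have code (0, 0).
module Submission where

open import Defs
open import Data.Nat using (ℕ; _≤_)
open import Data.Product using (_×_)
open import Relation.Binary.PropositionalEquality using (_≡_)

open import Data.Nat using (zero; suc; _+_; _∸_; _⊓_; ∣_-_∣; _<_; z≤n; s≤s)
open import Data.Nat.Properties
open import Data.Fin using (Fin; toℕ; fromℕ<) renaming (zero to fzero; suc to fsuc)
open import Data.Fin.Properties using (¬Fin0; toℕ-injective; toℕ-fromℕ<; toℕ<n)
open import Data.Product using (_,_)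
open import Data.Sum using (_⊎_; inj₁; inj₂)
open import Data.Empty using (⊥-elim)
open import Relation.Nullary using (¬_)
open import Relation.Binary.PropositionalEquality using (_≢_; refl; sym; trans; cong; subst)

module _ {n : ℕ} (G : Graph n) where

  Dist-adjacent : ∀ {u y} → Adj G u y → Dist G u y 1
  Dist-adjacent a = step a here , minimal
    where
    minimal : ∀ k → Walk G _ _ k → 1 ≤ k
    minimal zero here = ⊥-elim (irrefl G a)
    minimal (suc k) _ = s≤s z≤n

  EdgeDist-incident : ∀ {u y} → Adj G u y → EdgeDist G u u y 0
  EdgeDist-incident a = 0 , 1 , (here , λ _ _ → z≤n) , Dist-adjacent a , refl

  module _ {k : ℕ} (c : ProperEdgeColoring G k) where

    ClassDist-incident : ∀ {u y m} (a : Adj G u y) → ClassDist G c u (col c u y a) m → m ≡ 0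
    ClassDist-incident a (_ , minimal) = n≤0⇒n≡0 (minimal _ _ a refl 0 (EdgeDist-incident a))

  ¬ProperEdgeColoring-0 : ∀ {x y} → Adj G x y → ¬ ProperEdgeColoring G 0
  ¬ProperEdgeColoring-0 a c = ¬Fin0 (col c _ _ a)

  ¬ProperEdgeColoring-1 : ∀ {u x y} → Adj G u x → Adj G u y → x ≢ y → ¬ ProperEdgeColoring G 1
  ¬ProperEdgeColoring-1 a b x≢y c = proper c _ _ _ a b x≢y (Fin1-≡ _ _)
    where
    Fin1-≡ : (i j : Fin 1) → i ≡ j
    Fin1-≡ fzero fzero = refl

  Fin2-cover : ∀ {a b : Fin 2} → a ≢ b → ∀ i → i ≡ a ⊎ i ≡ b
  Fin2-cover {fzero}      {fzero}      a≢b _           = ⊥-elim (a≢b refl)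
  Fin2-cover {fsuc fzero} {fsuc fzero} a≢b _           = ⊥-elim (a≢b refl)
  Fin2-cover {fzero}      {fsuc fzero} _   fzero        = inj₁ refl
  Fin2-cover {fzero}      {fsuc fzero} _   (fsuc fzero) = inj₂ refl
  Fin2-cover {fsuc fzero} {fzero}      _   fzero        = inj₂ refl
  Fin2-cover {fsuc fzero} {fzero}      _   (fsuc fzero) = inj₁ refl

  -- With two colours, a vertex on two edges is incident to both colour classes.
  ClassDist-2-branch : (c : ProperEdgeColoring G 2) → ∀ {u x y} → Adj G u x → Adj G u y → x ≢ y →
                       ∀ {i m} → ClassDist G c u i m → m ≡ 0
  ClassDist-2-branch c a b x≢y {i} cd with Fin2-cover (proper c _ _ _ a b x≢y) i
  ... | inj₁ refl = ClassDist-incident c a cd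
  ... | inj₂ refl = ClassDist-incident c b cd

  ¬EdgeLocating-2 : (c : ProperEdgeColoring G 2) → ∀ {u v x y x′ y′} → u ≢ v →
                    Adj G u x → Adj G u y → x ≢ y → Adj G v x′ → Adj G v y′ → x′ ≢ y′ →
                    ¬ EdgeLocating G c
  ¬EdgeLocating-2 c u≢v a b x≢y a′ b′ x′≢y′ locating with locating _ _ u≢v
  ... | _ , _ , _ , cdᵤ , cdᵥ , m≢m′ =
    m≢m′ (trans (ClassDist-2-branch c a b x≢y cdᵤ) (sym (ClassDist-2-branch c a′ b′ x′≢y′ cdᵥ)))

∣n-1+n∣≡1 : ∀ n → ∣ n - suc n ∣ ≡ 1
∣n-1+n∣≡1 zero    = refl
∣n-1+n∣≡1 (suc n) = ∣n-1+n∣≡1 n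

edgeDist : ℕ → ℕ → ℕ
edgeDist v x = ∣ v - x ∣ ⊓ ∣ v - suc x ∣

edgeDist-0 : ∀ v → edgeDist v 0 ≡ v ∸ 1
edgeDist-0 zero    = refl
edgeDist-0 (suc v) rewrite ∣-∣-identityʳ v = m≥n⇒m⊓n≡n (n≤1+n v)

module Path (n : ℕ) where

  G : Graph n
  G = PathGraph n

  D : Fin n → Fin n → ℕ
  D u v = ∣ toℕ u - toℕ v ∣

  D-adjacent : ∀ {u w} → Adj G u w → D u w ≡ 1
  D-adjacent {u} (inj₁ p) rewrite p = ∣n-1+n∣≡1 (toℕ u)
  D-adjacent {w = w} (inj₂ p) rewrite p = trans (∣-∣-comm (suc (toℕ w)) (toℕ w)) (∣n-1+n∣≡1 (toℕ w))

  D≤walk : ∀ {u v k} → Walk G u v k → D u v ≤ k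
  D≤walk {u} here = ≤-reflexive (∣n-n∣≡0 (toℕ u))
  D≤walk {u} {v} (step {w = w} {k = k} a walk) = begin
    D u v         ≤⟨ ∣-∣-triangle (toℕ u) (toℕ w) (toℕ v) ⟩
    D u w + D w v ≡⟨ cong (_+ D w v) (D-adjacent a) ⟩
    suc (D w v)   ≤⟨ s≤s (D≤walk walk) ⟩
    suc k         ∎
    where open ≤-Reasoning

  walk-snoc : ∀ {u w v k} → Walk G u w k → Adj G w v → Walk G u v (suc k)
  walk-snoc here         a = step a here
  walk-snoc (step b walk) a = step b (walk-snoc walk a)

  walk-reverse : ∀ {u v k} → Walk G u v k → Walk G v u k
  walk-reverse here          = here
  walk-reverse (step a walk) = walk-snoc (walk-reverse walk) (symAdj G a)

  walk-ascending : ∀ k (u v : Fin n) → toℕ v ≡ toℕ u + k → Walk G u v k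
  walk-ascending zero u v v≡u+0 =
    subst (λ z → Walk G u z 0) (toℕ-injective (trans (sym (+-identityʳ (toℕ u))) (sym v≡u+0))) here
  walk-ascending (suc k) u v v≡u+1+k = step (inj₁ (toℕ-fromℕ< u+1<n)) (walk-ascending k w v v≡w+k)
    where
    v≡1+u+k : toℕ v ≡ suc (toℕ u + k)
    v≡1+u+k = trans v≡u+1+k (+-suc (toℕ u) k)
    u+1<n : suc (toℕ u) < n
    u+1<n = ≤-trans (s≤s (s≤s (m≤m+n (toℕ u) k))) (subst (_< n) v≡1+u+k (toℕ<n v))
    w = fromℕ< u+1<n
    v≡w+k : toℕ v ≡ toℕ w + k
    v≡w+k = trans v≡1+u+k (cong (_+ k) (sym (toℕ-fromℕ< u+1<n)))

  walk-D : ∀ u v → Walk G u v (D u v)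
  walk-D u v with ≤-total (toℕ u) (toℕ v)
  ... | inj₁ u≤v = subst (Walk G u v) (sym (m≤n⇒∣m-n∣≡n∸m u≤v))
                     (walk-ascending _ u v (sym (m+[n∸m]≡n u≤v)))
  ... | inj₂ v≤u = subst (Walk G u v) (sym (m≤n⇒∣n-m∣≡n∸m v≤u))
                     (walk-reverse (walk-ascending _ v u (sym (m+[n∸m]≡n v≤u))))

  Dist-D : ∀ u v → Dist G u v (D u v)
  Dist-D u v = walk-D u v , λ _ → D≤walk

  Dist⇒≡D : ∀ {u v d} → Dist G u v d → d ≡ D u v
  Dist⇒≡D {u} {v} (walk , minimal) = ≤-antisym (minimal _ (walk-D u v)) (D≤walk walk)

  EdgeDist⇒≡ : ∀ {v x y m} → EdgeDist G v x y m → m ≡ D v x ⊓ D v y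
  EdgeDist⇒≡ (_ , _ , dx , dy , m≡) rewrite Dist⇒≡D dx | Dist⇒≡D dy = m≡

  EdgeDist-D : ∀ v x y → EdgeDist G v x y (D v x ⊓ D v y)
  EdgeDist-D v x y = D v x , D v y , Dist-D v x , Dist-D v y , refl

  -- The edge {i, i + 1} receives the colour f i.
  module SequenceColoring {k : ℕ} (f : ℕ → Fin k)
                          (f-alternates : ∀ i → suc (suc i) < n → f i ≢ f (suc i)) where

    colour : ∀ x y → Adj G x y → Fin k
    colour x y (inj₁ _) = f (toℕ x)
    colour x y (inj₂ _) = f (toℕ y)

    colour-edge : ∀ x y (a : Adj G x y) (b : Adj G y x) → colour x y a ≡ colour y x b
    colour-edge x y (inj₁ _) (inj₂ _) = refl
    colour-edge x y (inj₂ _) (inj₁ _) = refl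
    colour-edge x y (inj₁ p) (inj₁ q) = ⊥-elim (m≢1+n+m (toℕ x) {1} (trans q (cong suc p)))
    colour-edge x y (inj₂ p) (inj₂ q) = ⊥-elim (m≢1+n+m (toℕ x) {1} (trans p (cong suc q)))

    colour-proper : ∀ x y z (a : Adj G x y) (b : Adj G x z) → y ≢ z → colour x y a ≢ colour x z b
    colour-proper x y z (inj₁ p) (inj₁ q) y≢z _ = y≢z (toℕ-injective (trans p (sym q)))
    colour-proper x y z (inj₂ p) (inj₂ q) y≢z _ = y≢z (toℕ-injective (suc-injective (trans (sym p) q)))
    colour-proper x y z (inj₁ p) (inj₂ q) _ fx≡fz =
      f-alternates (toℕ z) (subst (_< n) (trans p (cong suc q)) (toℕ<n y))
        (sym (subst (λ t → f t ≡ f (toℕ z)) q fx≡fz))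
    colour-proper x y z (inj₂ p) (inj₁ q) _ fy≡fx =
      f-alternates (toℕ y) (subst (_< n) (trans q (cong suc p)) (toℕ<n z))
        (subst (λ t → f (toℕ y) ≡ f t) p fy≡fx)

    coloring : ProperEdgeColoring G k
    coloring = record { col = colour ; col-edge = colour-edge ; proper = colour-proper }

    ClassDist-intro : ∀ v i m (x₀ y₀ : Fin n) → toℕ y₀ ≡ suc (toℕ x₀) → f (toℕ x₀) ≡ i →
                      m ≡ edgeDist (toℕ v) (toℕ x₀) →
                      (∀ x → f x ≡ i → m ≤ edgeDist (toℕ v) x) →
                      ClassDist G coloring v i m
    ClassDist-intro v i m x₀ y₀ y₀≡1+x₀ fx₀≡i m≡ minimal =
      (x₀ , y₀ , inj₁ y₀≡1+x₀ , fx₀≡i , subst (EdgeDist G v x₀ y₀) (sym m≡′) (EdgeDist-D v x₀ y₀)) ,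
      λ { x y (inj₁ p) fx≡i _ ed → subst (m ≤_) (sym (EdgeDist⇒≡ ed)) (bound x y p fx≡i)
        ; x y (inj₂ p) fy≡i _ ed → subst (m ≤_) (sym (trans (EdgeDist⇒≡ ed) (⊓-comm (D v x) (D v y))))
                                     (bound y x p fy≡i) }
      where
      m≡′ : m ≡ D v x₀ ⊓ D v y₀
      m≡′ rewrite y₀≡1+x₀ = m≡
      bound : ∀ x y → toℕ y ≡ suc (toℕ x) → f (toℕ x) ≡ i → m ≤ D v x ⊓ D v y
      bound x y p fx≡i rewrite p = minimal (toℕ x) fx≡i

module SequenceLocating (n′ : ℕ) {k : ℕ} (f : ℕ → Fin k)
                        (f-alternates : ∀ i → suc (suc i) < suc (suc (suc n′)) → f i ≢ f (suc i))
                        (f0-once : ∀ x → f x ≡ f 0 → x ≡ 0) where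

  open Path (suc (suc (suc n′)))
  open SequenceColoring f f-alternates

  ClassDist-first : ∀ v → ClassDist G coloring v (f 0) (toℕ v ∸ 1)
  ClassDist-first v = ClassDist-intro v (f 0) _ fzero (fsuc fzero) refl refl
    (sym (edgeDist-0 (toℕ v))) minimal
    where
    minimal : ∀ x → f x ≡ f 0 → toℕ v ∸ 1 ≤ edgeDist (toℕ v) x
    minimal x fx≡f0 rewrite f0-once x fx≡f0 = ≤-reflexive (sym (edgeDist-0 (toℕ v)))

  ClassDist-second-at-0 : ClassDist G coloring fzero (f 1) 1
  ClassDist-second-at-0 = ClassDist-intro fzero (f 1) 1 (fsuc fzero) (fsuc (fsuc fzero)) refl refl refl minimal
    where
    minimal : ∀ x → f x ≡ f 1 → 1 ≤ edgeDist 0 x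
    minimal zero    f0≡f1 = ⊥-elim (f-alternates 0 (s≤s (s≤s (s≤s z≤n))) f0≡f1)
    minimal (suc x) _     = s≤s z≤n

  ClassDist-second-at-1 : ClassDist G coloring (fsuc fzero) (f 1) 0
  ClassDist-second-at-1 = ClassDist-intro (fsuc fzero) (f 1) 0 (fsuc fzero) (fsuc (fsuc fzero)) refl refl refl
    λ _ _ → z≤n

  locating : EdgeLocating G coloring
  locating fzero        fzero        u≢v = ⊥-elim (u≢v refl)
  locating fzero        (fsuc fzero) _   = f 1 , 1 , 0 , ClassDist-second-at-0 , ClassDist-second-at-1 , λ ()
  locating (fsuc fzero) fzero        _   = f 1 , 0 , 1 , ClassDist-second-at-1 , ClassDist-second-at-0 , λ ()
  locating fzero (fsuc (fsuc w)) _ = f 0 , _ , _ , ClassDist-first fzero , ClassDist-first (fsuc (fsuc w)) , λ ()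
  locating (fsuc (fsuc w)) fzero _ = f 0 , _ , _ , ClassDist-first (fsuc (fsuc w)) , ClassDist-first fzero , λ ()
  locating (fsuc a) (fsuc b) u≢v = f 0 , _ , _ , ClassDist-first (fsuc a) , ClassDist-first (fsuc b) ,
    λ a≡b → u≢v (cong fsuc (toℕ-injective a≡b))

  hasEdgeLocatingColoring : HasEdgeLocatingColoring G k
  hasEdgeLocatingColoring = coloring , locating

two-colour-sequence : ℕ → Fin 2
two-colour-sequence zero    = fzero
two-colour-sequence (suc _) = fsuc fzero

three-colour-sequence : ℕ → Fin 3
three-colour-sequence zero                = fzero
three-colour-sequence (suc zero)          = fsuc fzero
three-colour-sequence (suc (suc zero))    = fsuc (fsuc fzero)
three-colour-sequence (suc (suc (suc i))) = three-colour-sequence (suc i)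

three-colour-sequence-alternates : ∀ i → three-colour-sequence i ≢ three-colour-sequence (suc i)
three-colour-sequence-alternates zero                = λ ()
three-colour-sequence-alternates (suc zero)          = λ ()
three-colour-sequence-alternates (suc (suc zero))    = λ ()
three-colour-sequence-alternates (suc (suc (suc i))) = three-colour-sequence-alternates (suc i)

three-colour-sequence-0-once : ∀ x → three-colour-sequence x ≡ fzero → x ≡ 0
three-colour-sequence-0-once zero                _ = refl
three-colour-sequence-0-once (suc zero)          ()
three-colour-sequence-0-once (suc (suc zero))    ()
three-colour-sequence-0-once (suc (suc (suc x))) p with three-colour-sequence-0-once (suc x) p
... | ()

P3-edgeLocating-2 : HasEdgeLocatingColoring (PathGraph 3) 2
P3-edgeLocating-2 = SequenceLocating.hasEdgeLocatingColoring 0 two-colour-sequence alternates once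
  where
  alternates : ∀ i → suc (suc i) < 3 → two-colour-sequence i ≢ two-colour-sequence (suc i)
  alternates zero _ = λ ()
  alternates (suc i) (s≤s (s≤s (s≤s ())))
  once : ∀ x → two-colour-sequence x ≡ fzero → x ≡ 0
  once zero _ = refl
  once (suc x) ()

P≥4-edgeLocating-3 : ∀ n′ → HasEdgeLocatingColoring (PathGraph (suc (suc (suc (suc n′))))) 3
P≥4-edgeLocating-3 n′ = SequenceLocating.hasEdgeLocatingColoring (suc n′) three-colour-sequence
  (λ i _ → three-colour-sequence-alternates i) three-colour-sequence-0-once

P≥3-edgeLocating-≥2 : ∀ n′ j → HasEdgeLocatingColoring (PathGraph (suc (suc (suc n′)))) j → 2 ≤ j
P≥3-edgeLocating-≥2 n′ zero          (c , _) = ⊥-elim (¬ProperEdgeColoring-0 _ {fzero} (inj₁ refl) c)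
P≥3-edgeLocating-≥2 n′ (suc zero)    (c , _) =
  ⊥-elim (¬ProperEdgeColoring-1 _ {fsuc fzero} {fzero} {fsuc (fsuc fzero)} (inj₂ refl) (inj₁ refl) (λ ()) c)
P≥3-edgeLocating-≥2 n′ (suc (suc j)) _ = s≤s (s≤s z≤n)

P≥4-edgeLocating-≥3 : ∀ n′ j → HasEdgeLocatingColoring (PathGraph (suc (suc (suc (suc n′))))) j → 3 ≤ j
P≥4-edgeLocating-≥3 n′ j h with P≥3-edgeLocating-≥2 (suc n′) j h
P≥4-edgeLocating-≥3 n′ (suc (suc zero)) (c , locating) | s≤s (s≤s z≤n) =
  ⊥-elim (¬EdgeLocating-2 _ c {fsuc fzero} {fsuc (fsuc fzero)} {fzero} {fsuc (fsuc fzero)}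
            {fsuc fzero} {fsuc (fsuc (fsuc fzero))}
            (λ ()) (inj₂ refl) (inj₁ refl) (λ ()) (inj₂ refl) (inj₁ refl) (λ ()) locating)
P≥4-edgeLocating-≥3 n′ (suc (suc (suc _))) _ | _ = s≤s (s≤s (s≤s z≤n))

proposition1 : ∀ (n : ℕ) → 3 ≤ n →
    (n ≡ 3 → EdgeLocChromaticNumber (PathGraph n) 2)
    × (4 ≤ n → EdgeLocChromaticNumber (PathGraph n) 3)
proposition1 (suc zero)             (s≤s ())
proposition1 (suc (suc zero))       (s≤s (s≤s ()))
proposition1 (suc (suc (suc zero))) _ =
  (λ _ → P3-edgeLocating-2 , P≥3-edgeLocating-≥2 0) , λ { (s≤s (s≤s (s≤s ()))) }
proposition1 (suc (suc (suc (suc n′)))) _ =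
  (λ ()) , λ _ → P≥4-edgeLocating-3 n′ , P≥4-edgeLocating-≥3 n′
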